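{- For $n=1$ and for $n=2$, there are only finitely many CS $n$-sets.
   Context: A CS-set is a finite multiset $\langle a_1,\dots,a_n\rangle$ of integers (repeated elements allowed, order irrelevant) such that $a_1^3+a_2^3+\cdots+a_n^3=(a_1+a_2+\cdots+a_n)^2$, where it is required that no $a_i$ equals $0$ and that the multiset does not contain both $k$ and $-k$ for any integer $k$. A CS $n$-set is a CS-set with exactly $n$ elements (counted with multiplicity); entries may be negative. -}

module Defs where

open import Data.Nat using (ℕ)
open import Data.Integer using (ℤ; _+_; _*_; -_; 0ℤ)
open import Data.List using (List; []; _∷_; length; map; foldr)
open import Data.List.Membership.Propositional using (_∈_)
open import Data.List.Relation.Unary.All using (All)
open import Data.List.Relation.Binary.Permutation.Propositional using (_↭_)
open import Data.Product using (_×_; ∃)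
open import Relation.Binary.PropositionalEquality using (_≡_)
open import Relation.Nullary using (¬_)

-- A finite multiset of integers is represented by a list; two lists represent
-- the same multiset iff they are permutations of each other (_↭_).

sumℤ : List ℤ → ℤ
sumℤ = foldr _+_ 0ℤ

cube : ℤ → ℤ
cube a = a * a * a

IsCSSet : List ℤ → Set
IsCSSet xs =
  All (λ a → ¬ (a ≡ 0ℤ)) xs
  × (∀ k → k ∈ xs → ¬ ((- k) ∈ xs))
  × (sumℤ (map cube xs) ≡ sumℤ xs * sumℤ xs)

IsCSnSet : ℕ → List ℤ → Set
IsCSnSet n xs = length xs ≡ n × IsCSSet xs

FinitelyManyCSnSets : ℕ → Set
FinitelyManyCSnSets n =
  ∃ λ (L : List (List ℤ)) → ∀ xs → IsCSnSet n xs → ∃ λ ys → ys ∈ L × (xs ↭ ys)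

-- For n = 1 the equation a³ = a² with a ≠ 0 forces a = 1.
-- For n = 2, a³ + b³ − (a + b)² = (a + b)(a² − ab + b² − a − b); the factor
-- a + b cannot vanish since b ≠ −a, so a² − ab + b² = a + b. Completing the
-- square, (2b − a − 1)² + 3(a − 1)² = 4, whence |a − 1| ≤ 1, i.e. a ∈ {1, 2}
-- as a ≠ 0, and symmetrically b ∈ {1, 2}. Of the four candidates only
-- ⟨1, 1⟩ fails, leaving the CS 2-sets ⟨1, 2⟩ and ⟨2, 2⟩.
module Submission where

open import Defs
open import Data.Empty using (⊥-elim)
open import Data.Integer using (ℤ; +_; -[1+_]; _+_; _*_; -_; _-_; 0ℤ; ∣_∣)
open import Data.Integer.Properties
  using (+-0-abelianGroup; +-injective; pos-+; pos-*; +-identityʳ; i*j≡0⇒i≡0∨j≡0; i-j≡0⇒i≡j; i≡j⇒i-j≡0)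
open import Algebra.Properties.AbelianGroup +-0-abelianGroup using (inverseʳ-unique)
open import Data.Integer.Tactic.RingSolver using (solve-∀)
open import Data.List using (List; []; _∷_)
open import Data.List.Membership.Propositional using (_∈_)
open import Data.List.Relation.Unary.All using ([]; _∷_)
open import Data.List.Relation.Unary.Any using (here; there)
open import Data.List.Relation.Binary.Permutation.Propositional using (_↭_; ↭-refl; ↭-swap)
open import Data.Nat as ℕ using (zero; suc; z≤n; s≤s)
open import Data.Nat.Properties using (*-mono-≤; *-monoʳ-≤; m≤n+m; <⇒≱; module ≤-Reasoning)
open import Data.Product using (_×_; _,_; ∃)
open import Data.Sum using (_⊎_; inj₁; inj₂)
open import Relation.Binary.PropositionalEquality
open import Relation.Nullary using (¬_)

i*i≡∣i∣*∣i∣ : ∀ i → i * i ≡ + (∣ i ∣ ℕ.* ∣ i ∣)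
i*i≡∣i∣*∣i∣ (+ n)    = sym (pos-* n n)
i*i≡∣i∣*∣i∣ -[1+ n ] = refl

m*m+3n*n≡4⇒n≤1 : ∀ m n → m ℕ.* m ℕ.+ 3 ℕ.* (n ℕ.* n) ≡ 4 → n ℕ.≤ 1
m*m+3n*n≡4⇒n≤1 m zero              _  = z≤n
m*m+3n*n≡4⇒n≤1 m (suc zero)        _  = s≤s z≤n
m*m+3n*n≡4⇒n≤1 m n@(suc (suc _))   eq = ⊥-elim (<⇒≱ (s≤s (s≤s (s≤s (s≤s (s≤s z≤n))))) 12≤4)
  where
  open ≤-Reasoning
  2≤n : 2 ℕ.≤ n
  2≤n = s≤s (s≤s z≤n)
  12≤4 : 12 ℕ.≤ 4
  12≤4 = begin
    12                           ≤⟨ *-monoʳ-≤ 3 (*-mono-≤ 2≤n 2≤n) ⟩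
    3 ℕ.* (n ℕ.* n)              ≤⟨ m≤n+m _ (m ℕ.* m) ⟩
    m ℕ.* m ℕ.+ 3 ℕ.* (n ℕ.* n)  ≡⟨ eq ⟩
    4                            ∎

x*x+3y*y≡4⇒∣y∣≤1 : ∀ x y → x * x + + 3 * (y * y) ≡ + 4 → ∣ y ∣ ℕ.≤ 1
x*x+3y*y≡4⇒∣y∣≤1 x y eq = m*m+3n*n≡4⇒n≤1 ∣ x ∣ ∣ y ∣ (+-injective (begin
  + (∣ x ∣ ℕ.* ∣ x ∣ ℕ.+ 3 ℕ.* (∣ y ∣ ℕ.* ∣ y ∣))
    ≡⟨ pos-+ (∣ x ∣ ℕ.* ∣ x ∣) _ ⟩
  + (∣ x ∣ ℕ.* ∣ x ∣) + + (3 ℕ.* (∣ y ∣ ℕ.* ∣ y ∣))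
    ≡⟨ cong (_+_ (+ (∣ x ∣ ℕ.* ∣ x ∣))) (pos-* 3 (∣ y ∣ ℕ.* ∣ y ∣)) ⟩
  + (∣ x ∣ ℕ.* ∣ x ∣) + + 3 * + (∣ y ∣ ℕ.* ∣ y ∣)
    ≡⟨ sym (cong₂ (λ p q → p + + 3 * q) (i*i≡∣i∣*∣i∣ x) (i*i≡∣i∣*∣i∣ y)) ⟩
  x * x + + 3 * (y * y)
    ≡⟨ eq ⟩
  + 4 ∎))
  where open ≡-Reasoning

nonzero∧∣i-1∣≤1⇒i≡1∨i≡2 : ∀ i → ¬ i ≡ 0ℤ → ∣ i - + 1 ∣ ℕ.≤ 1 → i ≡ + 1 ⊎ i ≡ + 2
nonzero∧∣i-1∣≤1⇒i≡1∨i≡2 (+ 0)                 i≢0 _        = ⊥-elim (i≢0 refl)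
nonzero∧∣i-1∣≤1⇒i≡1∨i≡2 (+ 1)                 _   _        = inj₁ refl
nonzero∧∣i-1∣≤1⇒i≡1∨i≡2 (+ 2)                 _   _        = inj₂ refl
nonzero∧∣i-1∣≤1⇒i≡1∨i≡2 (+ suc (suc (suc _))) _   (s≤s ())
nonzero∧∣i-1∣≤1⇒i≡1∨i≡2 -[1+ _ ]              _   (s≤s ())

cube≡square⇒≡1 : ∀ a → ¬ a ≡ 0ℤ → cube a ≡ a * a → a ≡ + 1
cube≡square⇒≡1 a a≢0 eq with i*j≡0⇒i≡0∨j≡0 (a * a) a²[a-1]≡0
  where
  factor : ∀ a → a * a * (a - + 1) ≡ a * a * a - a * a
  factor = solve-∀
  a²[a-1]≡0 : a * a * (a - + 1) ≡ 0ℤ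
  a²[a-1]≡0 = trans (factor a) (i≡j⇒i-j≡0 eq)
... | inj₁ a²≡0 with i*j≡0⇒i≡0∨j≡0 a a²≡0
...   | inj₁ a≡0 = ⊥-elim (a≢0 a≡0)
...   | inj₂ a≡0 = ⊥-elim (a≢0 a≡0)
cube≡square⇒≡1 a a≢0 eq | inj₂ a-1≡0 = i-j≡0⇒i≡j a (+ 1) a-1≡0

pairCofactor : ℤ → ℤ → ℤ
pairCofactor a b = a * a - a * b + b * b - (a + b)

pairCofactor-comm : ∀ a b → pairCofactor a b ≡ pairCofactor b a
pairCofactor-comm a b = identity a b
  where
  identity : ∀ a b → a * a - a * b + b * b - (a + b) ≡ b * b - b * a + a * a - (b + a)
  identity = solve-∀

cube+cube-square≡sum*pairCofactor :
  ∀ a b → cube a + cube b - (a + b) * (a + b) ≡ (a + b) * pairCofactor a b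
cube+cube-square≡sum*pairCofactor a b = identity a b
  where
  identity : ∀ a b → a * a * a + b * b * b - (a + b) * (a + b)
                   ≡ (a + b) * (a * a - a * b + b * b - (a + b))
  identity = solve-∀

pairCofactor≡0⇒a≡1∨a≡2 : ∀ a b → ¬ a ≡ 0ℤ → pairCofactor a b ≡ 0ℤ → a ≡ + 1 ⊎ a ≡ + 2
pairCofactor≡0⇒a≡1∨a≡2 a b a≢0 q≡0 =
  nonzero∧∣i-1∣≤1⇒i≡1∨i≡2 a a≢0
    (x*x+3y*y≡4⇒∣y∣≤1 (b + b - a - + 1) (a - + 1)
      (trans (complete-square a b) (cong (λ q → + 4 * q + + 4) q≡0)))
  where
  complete-square : ∀ a b → (b + b - a - + 1) * (b + b - a - + 1) + + 3 * ((a - + 1) * (a - + 1))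
                          ≡ + 4 * (a * a - a * b + b * b - (a + b)) + + 4
  complete-square = solve-∀

csPair-classification :
  ∀ a b → ¬ a ≡ 0ℤ → ¬ b ≡ 0ℤ → ¬ b ≡ - a → cube a + cube b ≡ (a + b) * (a + b) →
  (a ≡ + 1 × b ≡ + 2) ⊎ (a ≡ + 2 × b ≡ + 1) ⊎ (a ≡ + 2 × b ≡ + 2)
csPair-classification a b a≢0 b≢0 b≢-a eq
  with i*j≡0⇒i≡0∨j≡0 (a + b)
         (trans (sym (cube+cube-square≡sum*pairCofactor a b)) (i≡j⇒i-j≡0 eq))
... | inj₁ a+b≡0 = ⊥-elim (b≢-a (inverseʳ-unique a b a+b≡0))
... | inj₂ q≡0
  with pairCofactor≡0⇒a≡1∨a≡2 a b a≢0 q≡0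
     | pairCofactor≡0⇒a≡1∨a≡2 b a b≢0 (trans (pairCofactor-comm b a) q≡0)
... | inj₁ refl | inj₂ refl = inj₁ (refl , refl)
... | inj₂ refl | inj₁ refl = inj₂ (inj₁ (refl , refl))
... | inj₂ refl | inj₂ refl = inj₂ (inj₂ (refl , refl))
... | inj₁ refl | inj₁ refl with eq
...   | ()

sumℤ-singleton : ∀ a → sumℤ (a ∷ []) ≡ a
sumℤ-singleton = +-identityʳ

sumℤ-pair : ∀ a b → sumℤ (a ∷ b ∷ []) ≡ a + b
sumℤ-pair a b = cong (_+_ a) (+-identityʳ b)

finitelyManyCS1Sets : FinitelyManyCSnSets 1
finitelyManyCS1Sets = ((+ 1 ∷ []) ∷ []) , singleton
  where
  singleton : ∀ xs → IsCSnSet 1 xs → ∃ λ ys → ys ∈ (+ 1 ∷ []) ∷ [] × xs ↭ ys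
  singleton (a ∷ []) (refl , a≢0 ∷ [] , _ , eq) with cube≡square⇒≡1 a a≢0 eq′
    where
    eq′ : cube a ≡ a * a
    eq′ = trans (sym (sumℤ-singleton (cube a))) (trans eq (cong₂ _*_ (sumℤ-singleton a) (sumℤ-singleton a)))
  ... | refl = _ , here refl , ↭-refl

finitelyManyCS2Sets : FinitelyManyCSnSets 2
finitelyManyCS2Sets = csPairs , pair
  where
  csPairs : List (List ℤ)
  csPairs = (+ 1 ∷ + 2 ∷ []) ∷ (+ 2 ∷ + 2 ∷ []) ∷ []
  pair : ∀ xs → IsCSnSet 2 xs → ∃ λ ys → ys ∈ csPairs × xs ↭ ys
  pair (a ∷ b ∷ []) (refl , a≢0 ∷ b≢0 ∷ [] , no-opposite , eq)
    with csPair-classification a b a≢0 b≢0 b≢-a eq′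
    where
    eq′ : cube a + cube b ≡ (a + b) * (a + b)
    eq′ = trans (sym (sumℤ-pair (cube a) (cube b))) (trans eq (cong₂ _*_ (sumℤ-pair a b) (sumℤ-pair a b)))
    b≢-a : ¬ b ≡ - a
    b≢-a refl = no-opposite a (here refl) (there (here refl))
  ... | inj₁ (refl , refl)        = _ , here refl , ↭-refl
  ... | inj₂ (inj₁ (refl , refl)) = _ , here refl , ↭-swap _ _ ↭-refl
  ... | inj₂ (inj₂ (refl , refl)) = _ , there (here refl) , ↭-refl

proposition9 : FinitelyManyCSnSets 1 × FinitelyManyCSnSets 2
proposition9 = finitelyManyCS1Sets , finitelyManyCS2Sets
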